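{- For $n,k\ge0$ let $p_{n,k}$ be the number of integers $m\in[0,a_{2n+1})$ whose Kentucky-2 legal decomposition has exactly $k$ summands. Then the generating function $F(x,y):=\sum_{n,k\ge0}p_{n,k}x^ny^k$ satisfies \[ F(x,y)=\frac{1+2xy}{1-x-2x^2y}. \]
   Context: The Kentucky-2 sequence $(a_n)_{n\ge1}$: index $\ell$ belongs to bin $\lceil \ell/2\rceil$. A legal decomposition of $m\ge0$ using $\{a_1,\dots,a_N\}$ is $m=a_{\ell_1}+\cdots+a_{\ell_k}$, $k\ge0$, $1\le\ell_1<\cdots<\ell_k\le N$, with $\lceil \ell_{j+1}/2\rceil-\lceil \ell_j/2\rceil\ge2$ for all $j$. The sequence is defined by $a_1=1$ and, for $N\ge1$, $a_{N+1}$ is the smallest positive integer with no legal decomposition using $\{a_1,\dots,a_N\}$ (first terms $1,2,3,4,5,8,11,16,\dots$). Every nonnegative integer has a unique legal decomposition (that of $0$ is empty). -}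

module Defs where

open import Data.Nat using (ℕ; zero; suc; _+_; _*_; _∸_; _≤_; _<_; _≟_; _≤?_; _<?_; ⌈_/2⌉)
open import Data.List using (List; []; _∷_; _++_; [_]; map; filter; length; upTo; concatMap; foldr)
open import Data.Nat.ListAction using (sum)
open import Data.List.Relation.Unary.All using (All; all?)
open import Data.List.Relation.Unary.Any using (Any; any?)
open import Data.List.Relation.Unary.Linked using (Linked; linked?)
open import Data.Product using (_×_)
open import Relation.Nullary using (Dec; yes; no)
open import Relation.Nullary.Decidable using (_×-dec_)
open import Relation.Binary.PropositionalEquality using (_≡_)
open import Data.Integer as ℤ using (ℤ; +_; -_)

bin : ℕ → ℕ
bin ℓ = ⌈ ℓ /2⌉

BinGap : ℕ → ℕ → Set
BinGap ℓ ℓ' = (ℓ < ℓ') × (2 + bin ℓ ≤ bin ℓ')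

binGap? : (ℓ ℓ' : ℕ) → Dec (BinGap ℓ ℓ')
binGap? ℓ ℓ' = (ℓ <? ℓ') ×-dec (2 + bin ℓ ≤? bin ℓ')

InRange : ℕ → ℕ → Set
InRange N ℓ = (1 ≤ ℓ) × (ℓ ≤ N)

Legal : ℕ → List ℕ → Set
Legal N ls = All (InRange N) ls × Linked BinGap ls

legal? : (N : ℕ) (ls : List ℕ) → Dec (Legal N ls)
legal? N ls = all? (λ ℓ → (1 ≤? ℓ) ×-dec (ℓ ≤? N)) ls ×-dec linked? binGap? ls

subsets : {A : Set} → List A → List (List A)
subsets []       = [] ∷ []
subsets (x ∷ xs) = map (x ∷_) (subsets xs) ++ subsets xs

range : ℕ → List ℕ
range N = map suc (upTo N)

legalIndexLists : ℕ → List (List ℕ)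
legalIndexLists N = filter (legal? N) (subsets (range N))

-- 1-indexed lookup in a list (0 if out of range)
nth : List ℕ → ℕ → ℕ
nth []       _             = 0
nth (x ∷ xs) zero          = 0
nth (x ∷ xs) (suc zero)    = x
nth (x ∷ xs) (suc (suc i)) = nth xs (suc i)

RepBy : List ℕ → ℕ → ℕ → Set
RepBy pre N m = Any (λ ls → sum (map (nth pre) ls) ≡ m) (legalIndexLists N)

repBy? : (pre : List ℕ) (N m : ℕ) → Dec (RepBy pre N m)
repBy? pre N m = any? (λ ls → sum (map (nth pre) ls) ≟ m) (legalIndexLists N)

-- first c' ∈ {c, …, c+fuel-1} not representable; c+fuel if there is none
search : List ℕ → ℕ → ℕ → ℕ → ℕ
search pre N zero       c = c
search pre N (suc fuel) c with repBy? pre N c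
... | yes _ = search pre N fuel (suc c)
... | no  _ = c

-- smallest positive integer with no legal decomposition using pre = [a₁,…,a_N]
-- (sum pre + 1 is never representable, so searching 1 … sum pre + 1 suffices)
next : ℕ → List ℕ → ℕ
next N pre = search pre N (sum pre) 1

terms : ℕ → List ℕ
terms zero          = []
terms (suc zero)    = 1 ∷ []
terms (suc (suc N)) = terms (suc N) ++ [ next (suc N) (terms (suc N)) ]

-- a ℓ = a_ℓ  (ℓ ≥ 1; a 0 = 0 is a dummy value)
a : ℕ → ℕ
a ℓ = nth (terms ℓ) ℓ

value : List ℕ → ℕ
value ls = sum (map a ls)

-- m has a legal decomposition with exactly k summands.  Since a_ℓ ≥ ℓ,
-- any legal decomposition of m only uses indices ≤ m, so using
-- {a₁,…,a_m} loses nothing.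
HasDecomp : ℕ → ℕ → Set
HasDecomp k m = Any (λ ls → (length ls ≡ k) × (value ls ≡ m)) (legalIndexLists m)

hasDecomp? : (k m : ℕ) → Dec (HasDecomp k m)
hasDecomp? k m = any? (λ ls → (length ls ≟ k) ×-dec (value ls ≟ m)) (legalIndexLists m)

p : ℕ → ℕ → ℕ
p n k = length (filter (hasDecomp? k) (upTo (a (1 + 2 * n))))

-- Formal power series in x, y with integer coefficients:
-- f n k = coefficient of xⁿ yᵏ

Series : Set
Series = ℕ → ℕ → ℤ

sumℤ : List ℤ → ℤ
sumℤ = foldr ℤ._+_ (+ 0)

_⋆_ : Series → Series → Series
(f ⋆ g) n k =
  sumℤ (concatMap (λ i → map (λ j → f i j ℤ.* g (n ∸ i) (k ∸ j)) (upTo (suc k))) (upTo (suc n)))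

F : Series
F n k = + p n k

numer : Series
numer zero          zero       = + 1
numer (suc zero)    (suc zero) = + 2
numer _             _          = + 0

denom : Series
denom zero                zero       = + 1
denom (suc zero)          zero       = - (+ 1)
denom (suc (suc zero))    (suc zero) = - (+ 2)
denom _                   _          = + 0

module Submission where

-- 1. An explicit sequence A with A (ℓ + 1) = A ℓ + A (1 + lim ℓ), where
--    lim ℓ is the largest index at least two bins below ℓ.
-- 2. A Zeckendorf-type theorem: every m < A (N + 1) is the value of exactly
--    one greedy index list (decreasing, indices ≤ N, each index at most lim
--    of the previous one).
-- 3. Greedy lists are the reversed legal index lists and legalIndexLists N
--    enumerates all legal lists; so the search defining the sequence returns
--    A, i.e. a = A, and legal decompositions are the greedy ones.
-- 4. Splitting [0, A (ℓ + 1)) into [0, A ℓ) and A ℓ + [0, A (1 + lim ℓ)),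
--    where prepending ℓ adds one summand, gives the recurrence
--    p (n + 2, k) = p (n + 1, k) + 2 p (n, k − 1).
-- 5. Multiplying a series by 1 − x − 2x²y maps the coefficients of xⁿ to
--    f(n) − f(n − 1) − 2y f(n − 2); by the recurrence these vanish for
--    n ≥ 2, and the rows n = 0, 1 are computed.

open import Defs
open import Data.Nat using (ℕ; zero; suc; _+_; _*_; _∸_; _≤_; _<_; _≟_; _<?_; z≤n; s≤s)
open import Data.Nat.Properties
open import Data.Nat.Tactic.RingSolver using (solve-∀)
open import Data.Integer as ℤ using (ℤ; +_; -_)
import Data.Integer.Properties as ℤ
import Data.Integer.Tactic.RingSolver as ℤ-Solver
open import Relation.Binary.PropositionalEquality hiding ([_])
open import Relation.Nullary using (yes; no; ¬_; Dec)
open import Data.Product using (_×_; _,_; proj₁; proj₂; ∃-syntax)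
open import Data.Empty using (⊥-elim)
open import Data.Unit using (⊤; tt)
open import Data.List using (List; []; _∷_; _++_; [_]; length; map; concat; concatMap; reverse; foldl; upTo; applyUpTo; filter)
open import Data.List.Properties using (map-upTo; reverse-map; length-++; length-reverse; filter-≐; filter-++; filter-none; upTo-∷ʳ; applyUpTo-∷ʳ; ++-assoc; ++-identityʳ)
open import Data.List.Membership.Propositional using (_∈_; find; lose)
open import Data.List.Relation.Binary.Permutation.Propositional.Properties using (↭-reverse)
open import Data.Nat.ListAction.Properties using (sum-++; sum-↭)
open import Data.List.Membership.Propositional.Properties using (∈-map⁺; ∈-++⁺ˡ; ∈-++⁺ʳ; ∈-upTo⁺; ∈-upTo⁻; ∈-filter⁺; ∈-filter⁻)
open import Data.List.Relation.Unary.Any using (here; there)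
open import Data.List.Relation.Binary.Sublist.Propositional using (_⊆_; []; _∷_; _∷ʳ_; minimum)
open import Data.List.Relation.Unary.All using (All; []; _∷_)
import Data.List.Relation.Unary.All as All
open import Data.List.Relation.Unary.Linked using (Linked; []; [-]; _∷_)
import Data.List.Relation.Unary.Linked as Linked
open import Data.List.Relation.Unary.Linked.Properties using (Linked⇒All; applyUpTo⁺₂)
open import Function using (flip)
open import Data.Nat.ListAction using (sum)

-- An explicit description A of the Kentucky-2 sequence: A₁,…,A₄ = 1,2,3,4 and
-- A (ℓ + 5) = A (ℓ + 3) + 2·A (ℓ + 1).  (A 0 = 0 matches the dummy value a 0.)
A : ℕ → ℕ
A 0 = 0
A 1 = 1
A 2 = 2
A 3 = 3
A 4 = 4
A (suc (suc (suc (suc (suc ℓ))))) = A (suc (suc (suc ℓ))) + 2 * A (suc ℓ)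

-- lim ℓ is the largest index whose bin lies at least two bins below that
-- of ℓ (0 if there is none); in closed form lim ℓ = 2·(⌈ℓ/2⌉ ∸ 2).
lim : ℕ → ℕ
lim 0 = 0
lim 1 = 0
lim 2 = 0
lim 3 = 0
lim 4 = 0
lim (suc (suc (suc (suc (suc ℓ))))) = suc (suc (lim (suc (suc (suc ℓ)))))

-- The defining recursion: the numbers representable with indices ≤ ℓ are
-- those representable with indices < ℓ together with A ℓ plus a number
-- representable with indices ≤ lim ℓ; hence A (ℓ + 1) = A ℓ + A (1 + lim ℓ).
A-step : ∀ ℓ → A ℓ + A (suc (lim ℓ)) ≡ A (suc ℓ)
A-step 0 = refl
A-step 1 = refl
A-step 2 = refl
A-step 3 = refl
A-step 4 = refl
A-step 5 = refl
A-step 6 = refl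
A-step (suc (suc (suc (suc (suc (suc (suc ℓ))))))) =
  combine (A (5 + ℓ)) (A (3 + ℓ)) (A (3 + lim (3 + ℓ))) (A (1 + lim (3 + ℓ)))
          (A-step (suc (suc (suc (suc (suc ℓ)))))) (A-step (suc (suc (suc ℓ))))
  where
  -- A (ℓ+7) + A (1 + lim (ℓ+7)) splits, by the recursion of A applied to
  -- both summands, into the instances ℓ+5 and ℓ+3 of the identity.
  combine : ∀ a b c d {e f} → a + c ≡ e → b + d ≡ f → (a + 2 * b) + (c + 2 * d) ≡ e + 2 * f
  combine a b c d refl refl = regroup a b c d
    where
    regroup : ∀ a b c d → (a + 2 * b) + (c + 2 * d) ≡ (a + c) + 2 * (b + d)
    regroup = solve-∀

lim-below : ∀ ℓ → lim (suc ℓ) ≤ ℓ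
lim-below 0 = z≤n
lim-below 1 = z≤n
lim-below 2 = z≤n
lim-below 3 = z≤n
lim-below (suc (suc (suc (suc ℓ)))) = s≤s (s≤s (lim-below (suc (suc ℓ))))

lim-≤ : ∀ ℓ → lim ℓ ≤ ℓ
lim-≤ zero    = z≤n
lim-≤ (suc ℓ) = ≤-trans (lim-below ℓ) (n≤1+n ℓ)

A-pos : ∀ ℓ → 0 < A (suc ℓ)
A-pos 0 = s≤s z≤n
A-pos 1 = s≤s z≤n
A-pos 2 = s≤s z≤n
A-pos 3 = s≤s z≤n
A-pos (suc (suc (suc (suc ℓ)))) = ≤-trans (A-pos (suc (suc ℓ))) (m≤m+n _ _)

A-suc : ∀ ℓ → A ℓ < A (suc ℓ)
A-suc ℓ = subst (A ℓ <_) (A-step ℓ) (subst (_≤ A ℓ + A (suc (lim ℓ))) (+-comm (A ℓ) 1)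
            (+-monoʳ-≤ (A ℓ) (A-pos (lim ℓ))))

A-mono : ∀ {m n} → m ≤ n → A m ≤ A n
A-mono {m} {n} m≤n with m≤n⇒∃[o]m+o≡n m≤n
... | o , refl = go o
  where
  go : ∀ o → A m ≤ A (m + o)
  go zero    = ≤-reflexive (cong A (sym (+-identityʳ m)))
  go (suc o) = subst (λ x → A m ≤ A x) (sym (+-suc m o)) (≤-trans (go o) (<⇒≤ (A-suc (m + o))))

A-reflects-< : ∀ {m n} → A m < A n → m < n
A-reflects-< {m} {n} Am<An with m <? n
... | yes m<n = m<n
... | no  m≮n = ⊥-elim (<-irrefl refl (<-≤-trans Am<An (A-mono (≮⇒≥ m≮n))))

A-≥-index : ∀ n → n ≤ A n
A-≥-index zero    = z≤n
A-≥-index (suc n) = <-≤-trans (s≤s (A-≥-index n)) (A-suc n)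

-- These are the
-- reversed legal index lists (legal⇒greedy, greedy⇒legal).
Greedy : ℕ → List ℕ → Set
Greedy N []      = ⊤
Greedy N (ℓ ∷ r) = 1 ≤ ℓ × ℓ ≤ N × Greedy (lim ℓ) r

val : List ℕ → ℕ
val ls = sum (map A ls)

greedy-weaken : ∀ {N M} ls → N ≤ M → Greedy N ls → Greedy M ls
greedy-weaken []      _   _               = tt
greedy-weaken (ℓ ∷ r) N≤M (1≤ℓ , ℓ≤N , g) = 1≤ℓ , ≤-trans ℓ≤N N≤M , g

greedy-bound : ∀ N ls → Greedy N ls → val ls < A (suc N)
greedy-bound N []      _               = A-pos N
greedy-bound N (ℓ ∷ r) (1≤ℓ , ℓ≤N , g) = begin-strict
  A ℓ + val r             <⟨ +-monoʳ-< (A ℓ) (greedy-bound (lim ℓ) r g) ⟩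
  A ℓ + A (suc (lim ℓ))   ≡⟨ A-step ℓ ⟩
  A (suc ℓ)               ≤⟨ A-mono (s≤s ℓ≤N) ⟩
  A (suc N)               ∎
  where open ≤-Reasoning

greedy-tighten : ∀ {N} M ls → Greedy N ls → val ls < A (suc M) → Greedy M ls
greedy-tighten M []      _               _ = tt
greedy-tighten M (ℓ ∷ r) (1≤ℓ , _ , g) v<A =
  1≤ℓ , ≤-pred (A-reflects-< (≤-<-trans (m≤m+n (A ℓ) (val r)) v<A)) , g

greedy-remainder : ∀ ℓ m → A ℓ ≤ m → m < A (suc ℓ) → m ∸ A ℓ < A (suc (lim ℓ))
greedy-remainder ℓ m Aℓ≤m m<A =
  +-cancelˡ-< (A ℓ) _ _ (subst₂ _<_ (sym (m+[n∸m]≡n Aℓ≤m)) (sym (A-step ℓ)) m<A)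

greedy-exists : ∀ N m → m < A (suc N) → ∃[ ls ] Greedy N ls × val ls ≡ m
greedy-exists zero    zero    _ = [] , tt , refl
greedy-exists zero    (suc m) (s≤s ())
greedy-exists (suc N) m m<A with m <? A (suc N)
... | yes m<A′ with greedy-exists N m m<A′
...   | ls , g , v = ls , greedy-weaken ls (n≤1+n N) g , v
greedy-exists (suc N) m m<A | no m≮A′
  with greedy-exists N (m ∸ A (suc N))
         (<-≤-trans (greedy-remainder (suc N) m (≮⇒≥ m≮A′) m<A) (A-mono (s≤s (lim-below N))))
... | ls , g , v =
  suc N ∷ ls ,
  (s≤s z≤n , ≤-refl , greedy-tighten (lim (suc N)) ls g
                        (subst (_< A (suc (lim (suc N)))) (sym v) (greedy-remainder (suc N) m (≮⇒≥ m≮A′) m<A))) ,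
  trans (cong (_+_ (A (suc N))) v) (m+[n∸m]≡n (≮⇒≥ m≮A′))

greedy-leading : ∀ {N} ℓ r → Greedy N (ℓ ∷ r) → A ℓ ≤ val (ℓ ∷ r) × val (ℓ ∷ r) < A (suc ℓ)
greedy-leading ℓ r (1≤ℓ , _ , g) = m≤m+n (A ℓ) (val r) , greedy-bound ℓ (ℓ ∷ r) (1≤ℓ , ≤-refl , g)

leading-index : ∀ {ℓ ℓ′ v} → A ℓ ≤ v → v < A (suc ℓ′) → ℓ ≤ ℓ′
leading-index Aℓ≤v v<A = ≤-pred (A-reflects-< (≤-<-trans Aℓ≤v v<A))

nonempty-positive : ∀ {N} ℓ r → Greedy N (ℓ ∷ r) → 0 < val (ℓ ∷ r)
nonempty-positive zero    r (() , _)
nonempty-positive (suc ℓ) r _ = ≤-trans (A-pos ℓ) (m≤m+n (A (suc ℓ)) (val r))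

greedy-unique : ∀ {N N′} ls ls′ → Greedy N ls → Greedy N′ ls′ → val ls ≡ val ls′ → ls ≡ ls′
greedy-unique []      []        _ _  _ = refl
greedy-unique []      (ℓ′ ∷ r′) _ g′ e = ⊥-elim (<-irrefl e (nonempty-positive ℓ′ r′ g′))
greedy-unique (ℓ ∷ r) []        g _  e = ⊥-elim (<-irrefl (sym e) (nonempty-positive ℓ r g))
greedy-unique (ℓ ∷ r) (ℓ′ ∷ r′) g g′ e =
  cong₂ _∷_ ℓ≡ℓ′ (greedy-unique r r′ (proj₂ (proj₂ g)) (proj₂ (proj₂ g′))
                   (+-cancelˡ-≡ (A ℓ) _ _ (trans e (cong (λ i → A i + val r′) (sym ℓ≡ℓ′)))))
  where
  ℓ≡ℓ′ : ℓ ≡ ℓ′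
  ℓ≡ℓ′ = ≤-antisym
    (leading-index (proj₁ (greedy-leading ℓ r g)) (subst (_< A (suc ℓ′)) (sym e) (proj₂ (greedy-leading ℓ′ r′ g′))))
    (leading-index (proj₁ (greedy-leading ℓ′ r′ g′)) (subst (_< A (suc ℓ)) e (proj₂ (greedy-leading ℓ r g))))

gap⇒≤lim : ∀ x y → 2 + bin x ≤ bin y → x ≤ lim y
gap⇒≤lim 0       y _ = z≤n
gap⇒≤lim (suc x) 0 ()
gap⇒≤lim (suc x) 1 (s≤s ())
gap⇒≤lim (suc x) 2 (s≤s ())
gap⇒≤lim (suc x) 3 (s≤s (s≤s ()))
gap⇒≤lim (suc x) 4 (s≤s (s≤s ()))
gap⇒≤lim 1 (suc (suc (suc (suc (suc y))))) _ = s≤s z≤n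
gap⇒≤lim 2 (suc (suc (suc (suc (suc y))))) _ = s≤s (s≤s z≤n)
gap⇒≤lim (suc (suc (suc x))) (suc (suc (suc (suc (suc y))))) (s≤s (s≤s gap)) =
  s≤s (s≤s (gap⇒≤lim (suc x) (suc (suc (suc y))) (s≤s gap)))

≤lim⇒gap : ∀ x y → 1 ≤ x → x ≤ lim y → BinGap x y
≤lim⇒gap x 0       1≤x x≤0 = ⊥-elim (<-irrefl refl (≤-trans 1≤x x≤0))
≤lim⇒gap x (suc y) 1≤x x≤lim = s≤s (≤-trans x≤lim (lim-below y)) , bins x (suc y) 1≤x x≤lim
  where
  bins : ∀ x y → 1 ≤ x → x ≤ lim y → 2 + bin x ≤ bin y
  bins (suc x) 0 _ ()
  bins (suc x) 1 _ ()
  bins (suc x) 2 _ ()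
  bins (suc x) 3 _ ()
  bins (suc x) 4 _ ()
  bins 1 (suc (suc (suc (suc (suc y))))) _ _ = s≤s (s≤s (s≤s z≤n))
  bins 2 (suc (suc (suc (suc (suc y))))) _ _ = s≤s (s≤s (s≤s z≤n))
  bins (suc (suc (suc x))) (suc (suc (suc (suc (suc y))))) _ (s≤s (s≤s x≤lim)) =
    s≤s (bins (suc x) (suc (suc (suc y))) (s≤s z≤n) x≤lim)

module _ {X : Set} {R : X → X → Set} where

  linked-reverse : ∀ xs → Linked R xs → Linked (flip R) (reverse xs)
  linked-reverse []       _  = []
  linked-reverse (x ∷ xs) lk = go x xs [] lk [-]
    where
    go : ∀ x xs acc → Linked R (x ∷ xs) → Linked (flip R) (x ∷ acc) →
         Linked (flip R) (foldl (flip _∷_) (x ∷ acc) xs)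
    go x []       acc _          racc = racc
    go x (y ∷ ys) acc (Rxy ∷ lk) racc = go y ys (x ∷ acc) lk (Rxy ∷ racc)

module _ {X : Set} {P : X → Set} where

  all-reverse : ∀ xs → All P xs → All P (reverse xs)
  all-reverse xs = go [] xs []
    where
    go : ∀ acc xs → All P acc → All P xs → All P (foldl (flip _∷_) acc xs)
    go acc []       pacc []         = pacc
    go acc (x ∷ xs) pacc (px ∷ pxs) = go (x ∷ acc) xs (px ∷ pacc) pxs

BinGap-trans : ∀ {x y z} → BinGap x y → BinGap y z → BinGap x z
BinGap-trans (x<y , gxy) (y<z , gyz) = <-trans x<y y<z , ≤-trans gxy (≤-trans (m≤n+m _ 2) gyz)

ReverseLegal : ℕ → List ℕ → Set
ReverseLegal N ys = All (InRange N) ys × Linked (flip BinGap) ys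

greedy⇒reverseLegal : ∀ {N} ys → Greedy N ys → ReverseLegal N ys
greedy⇒reverseLegal []      _               = [] , []
greedy⇒reverseLegal (ℓ ∷ r) (1≤ℓ , ℓ≤N , g) =
  (1≤ℓ , ℓ≤N) ∷ All.map (λ (1≤x , x≤lim) → 1≤x , ≤-trans x≤lim (≤-trans (lim-≤ ℓ) ℓ≤N)) (proj₁ rest) ,
  link r (proj₁ rest) (proj₂ rest)
  where
  rest : ReverseLegal (lim ℓ) r
  rest = greedy⇒reverseLegal r g
  link : ∀ r → All (InRange (lim ℓ)) r → Linked (flip BinGap) r → Linked (flip BinGap) (ℓ ∷ r)
  link []      _                   _  = [-]
  link (x ∷ r) ((1≤x , x≤lim) ∷ _) lk = ≤lim⇒gap x ℓ 1≤x x≤lim ∷ lk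

reverseLegal⇒greedy : ∀ {N} ys → ReverseLegal N ys → Greedy N ys
reverseLegal⇒greedy []      _                                = tt
reverseLegal⇒greedy (ℓ ∷ r) ((1≤ℓ , ℓ≤N) ∷ in-range , chain) =
  1≤ℓ , ℓ≤N , reverseLegal⇒greedy r (All.zipWith below-lim (in-range , gaps r chain) , Linked.tail chain)
  where
  below-lim : ∀ {x} → InRange _ x × BinGap x ℓ → InRange (lim ℓ) x
  below-lim {x} ((1≤x , _) , (_ , gap)) = 1≤x , gap⇒≤lim x ℓ gap
  gaps : ∀ r → Linked (flip BinGap) (ℓ ∷ r) → All (λ x → BinGap x ℓ) r
  gaps []      _          = []
  gaps (x ∷ r) (gap ∷ lk) = Linked⇒All (λ g₁ g₂ → BinGap-trans g₂ g₁) gap lk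

legal⇒greedy : ∀ N xs → Legal N xs → Greedy N (reverse xs)
legal⇒greedy N xs (in-range , chain) =
  reverseLegal⇒greedy (reverse xs) (all-reverse xs in-range , linked-reverse xs chain)

greedy⇒legal : ∀ N ys → Greedy N ys → Legal N (reverse ys)
greedy⇒legal N ys g with greedy⇒reverseLegal ys g
... | in-range , chain = all-reverse ys in-range , linked-reverse ys chain

increasing-head : ∀ {x xs} → Linked _<_ (x ∷ xs) → All (x <_) xs
increasing-head [-]        = []
increasing-head (x<y ∷ lk) = Linked⇒All <-trans x<y lk

drop-smaller : ∀ {y ys} zs → All (y <_) zs → All (_∈ y ∷ ys) zs → All (_∈ ys) zs
drop-smaller zs above mem = All.zipWith drop (above , mem)
  where
  drop : ∀ {y ys z} → y < z × z ∈ y ∷ ys → z ∈ ys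
  drop (y<z , here z≡y) = ⊥-elim (<-irrefl (sym z≡y) y<z)
  drop (_   , there z∈) = z∈

increasing-⊆ : ∀ xs ys → Linked _<_ xs → Linked _<_ ys → All (_∈ ys) xs → xs ⊆ ys
increasing-⊆ []       ys       _  _   _                  = minimum ys
increasing-⊆ (x ∷ xs) []       _  _   (() ∷ _)
increasing-⊆ (x ∷ xs) (y ∷ ys) lk lky (here refl ∷ mem)  =
  refl ∷ increasing-⊆ xs ys (Linked.tail lk) (Linked.tail lky) (drop-smaller xs (increasing-head lk) mem)
increasing-⊆ (x ∷ xs) (y ∷ ys) lk lky mem@(there x∈ys ∷ _) =
  y ∷ʳ increasing-⊆ (x ∷ xs) ys lk (Linked.tail lky)
         (drop-smaller (x ∷ xs) (y<x ∷ All.map (<-trans y<x) (increasing-head lk)) mem)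
  where
  y<x : y < x
  y<x = All.lookup (increasing-head lky) x∈ys

⊆⇒∈subsets : ∀ {xs ys : List ℕ} → xs ⊆ ys → xs ∈ subsets ys
⊆⇒∈subsets []                   = here refl
⊆⇒∈subsets (_∷ʳ_ {ys = ys} y s) = ∈-++⁺ʳ (map (y ∷_) (subsets ys)) (⊆⇒∈subsets s)
⊆⇒∈subsets (refl ∷ s)           = ∈-++⁺ˡ (∈-map⁺ (_ ∷_) (⊆⇒∈subsets s))

legal⇒∈legalIndexLists : ∀ N xs → Legal N xs → xs ∈ legalIndexLists N
legal⇒∈legalIndexLists N xs lg@(in-range , lk) =
  ∈-filter⁺ (legal? N) {xs = subsets (range N)}
    (⊆⇒∈subsets (increasing-⊆ xs (range N) (Linked.map proj₁ lk) range-increasing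
                                 (All.map in-range⇒∈ in-range)))
    lg
  where
  range-increasing : Linked _<_ (range N)
  range-increasing = subst (Linked _<_) (sym (map-upTo suc N)) (applyUpTo⁺₂ suc N (λ i → n<1+n (suc i)))
  in-range⇒∈ : ∀ {x} → InRange N x → x ∈ range N
  in-range⇒∈ {zero}  (() , _)
  in-range⇒∈ {suc x} (_ , x<N) = ∈-map⁺ suc (∈-upTo⁺ x<N)

∈legalIndexLists⇒legal : ∀ N xs → xs ∈ legalIndexLists N → Legal N xs
∈legalIndexLists⇒legal N xs mem = proj₂ (∈-filter⁻ (legal? N) {xs = subsets (range N)} mem)

val-reverse : ∀ ls → val (reverse ls) ≡ val ls
val-reverse ls = trans (cong sum (reverse-map A ls)) (sum-↭ (↭-reverse (map A ls)))

-- initial N = [A 1, …, A N]; it will turn out to be terms N.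
initial : ℕ → List ℕ
initial zero    = []
initial (suc N) = initial N ++ [ A (suc N) ]

length-initial : ∀ N → length (initial N) ≡ N
length-initial zero    = refl
length-initial (suc N) = trans (length-++ (initial N)) (trans (+-comm (length (initial N)) 1) (cong suc (length-initial N)))

nth-++ˡ : ∀ xs ys ℓ → 1 ≤ ℓ → ℓ ≤ length xs → nth (xs ++ ys) ℓ ≡ nth xs ℓ
nth-++ˡ (x ∷ xs) ys 1             _ _       = refl
nth-++ˡ (x ∷ xs) ys (suc (suc ℓ)) _ (s≤s h) = nth-++ˡ xs ys (suc ℓ) (s≤s z≤n) h

nth-last : ∀ xs y → nth (xs ++ [ y ]) (suc (length xs)) ≡ y
nth-last []           y = refl
nth-last (x ∷ [])     y = refl
nth-last (x ∷ x′ ∷ xs) y = nth-last (x′ ∷ xs) y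

nth-initial : ∀ N ℓ → InRange N ℓ → nth (initial N) ℓ ≡ A ℓ
nth-initial zero    (suc ℓ) (_ , ())
nth-initial (suc N) ℓ (1≤ℓ , ℓ≤N) with ℓ ≟ suc N
... | yes refl = subst (λ i → nth (initial N ++ [ A (suc N) ]) (suc i) ≡ A (suc N))
                       (length-initial N) (nth-last (initial N) (A (suc N)))
... | no  ℓ≢   = trans (nth-++ˡ (initial N) _ ℓ 1≤ℓ (subst (ℓ ≤_) (sym (length-initial N)) ℓ≤N′))
                       (nth-initial N ℓ (1≤ℓ , ℓ≤N′))
  where
  ℓ≤N′ : ℓ ≤ N
  ℓ≤N′ = ≤-pred (≤∧≢⇒< ℓ≤N ℓ≢)

sum-nth-initial : ∀ N ls → All (InRange N) ls → sum (map (nth (initial N)) ls) ≡ val ls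
sum-nth-initial N []       []                = refl
sum-nth-initial N (ℓ ∷ ls) (in-range ∷ rest) = cong₂ _+_ (nth-initial N ℓ in-range) (sum-nth-initial N ls rest)

representable : ∀ N m → m < A (suc N) → RepBy (initial N) N m
representable N m m<A with greedy-exists N m m<A
... | ys , g , v = lose (legal⇒∈legalIndexLists N (reverse ys) lg)
                        (trans (sum-nth-initial N (reverse ys) (proj₁ lg)) (trans (val-reverse ys) v))
  where
  lg : Legal N (reverse ys)
  lg = greedy⇒legal N ys g

representable⇒bound : ∀ N m → RepBy (initial N) N m → m < A (suc N)
representable⇒bound N m rep with find rep
... | xs , mem , v = subst (_< A (suc N)) value≡m
                       (greedy-bound N (reverse xs) (legal⇒greedy N xs lg))
  where
  lg : Legal N xs
  lg = ∈legalIndexLists⇒legal N xs mem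
  value≡m : val (reverse xs) ≡ m
  value≡m = trans (val-reverse xs) (trans (sym (sum-nth-initial N xs (proj₁ lg))) v)

search-finds : ∀ pre N fuel c t → c ≤ t → t ≤ c + fuel →
               (∀ x → c ≤ x → x < t → RepBy pre N x) → ¬ RepBy pre N t →
               search pre N fuel c ≡ t
search-finds pre N zero c t c≤t t≤c _ _ = ≤-antisym c≤t (subst (t ≤_) (+-identityʳ c) t≤c)
search-finds pre N (suc fuel) c t c≤t t≤c+f below not-t with repBy? pre N c | c ≟ t
... | yes rep-c | yes refl = ⊥-elim (not-t rep-c)
... | yes _     | no  c≢t  = search-finds pre N fuel (suc c) t (≤∧≢⇒< c≤t c≢t) (subst (t ≤_) (+-suc c fuel) t≤c+f)
                               (λ x c<x x<t → below x (≤-trans (n≤1+n c) c<x) x<t) not-t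
... | no  _     | yes c≡t  = c≡t
... | no  ¬rep  | no  c≢t  = ⊥-elim (¬rep (below c ≤-refl (≤∧≢⇒< c≤t c≢t)))

sum-initial-suc : ∀ N → sum (initial (suc N)) ≡ sum (initial N) + A (suc N)
sum-initial-suc N = trans (sum-++ (initial N) [ A (suc N) ]) (cong (_+_ (sum (initial N))) (+-identityʳ (A (suc N))))

-- The search window of next is large enough: A (N + 1) ≤ 1 + A 1 + ⋯ + A N.
A-≤-sum : ∀ N → A (suc N) ≤ suc (sum (initial N))
A-≤-sum zero    = ≤-refl
A-≤-sum (suc N) = begin
  A (suc (suc N))                      ≡⟨ sym (A-step (suc N)) ⟩
  A (suc N) + A (suc (lim (suc N)))    ≤⟨ +-monoʳ-≤ (A (suc N)) (A-mono (s≤s (lim-below N))) ⟩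
  A (suc N) + A (suc N)                ≤⟨ +-monoʳ-≤ (A (suc N)) (A-≤-sum N) ⟩
  A (suc N) + suc (sum (initial N))    ≡⟨ +-suc (A (suc N)) _ ⟩
  suc (A (suc N) + sum (initial N))    ≡⟨ cong suc (trans (+-comm (A (suc N)) _) (sym (sum-initial-suc N))) ⟩
  suc (sum (initial (suc N)))          ∎
  where open ≤-Reasoning

next-initial : ∀ N → next (suc N) (initial (suc N)) ≡ A (suc (suc N))
next-initial N =
  search-finds (initial (suc N)) (suc N) _ 1 (A (suc (suc N))) (A-pos (suc N)) (A-≤-sum (suc N))
    (λ x _ x<A → representable (suc N) x x<A)
    (λ rep → <-irrefl refl (representable⇒bound (suc N) _ rep))

terms≡initial : ∀ N → terms N ≡ initial N
terms≡initial zero          = refl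
terms≡initial (suc zero)    = refl
terms≡initial (suc (suc N)) rewrite terms≡initial (suc N) | next-initial N = refl

a≡A : ∀ ℓ → a ℓ ≡ A ℓ
a≡A zero    = refl
a≡A (suc ℓ) = trans (cong (λ ts → nth ts (suc ℓ)) (terms≡initial (suc ℓ)))
                    (nth-initial (suc ℓ) (suc ℓ) (s≤s z≤n , ≤-refl))

value≡val : ∀ ls → value ls ≡ val ls
value≡val []       = refl
value≡val (ℓ ∷ ls) = cong₂ _+_ (a≡A ℓ) (value≡val ls)

-- The unique greedy decomposition of m (indices ≤ m suffice, as m < A (m + 1)).
decomposition : ∀ m → ∃[ ys ] Greedy m ys × val ys ≡ m
decomposition m = greedy-exists m m (A-≥-index (suc m))

summands : ℕ → ℕ
summands m = length (proj₁ (decomposition m))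

greedy≡decomposition : ∀ {N} ys → Greedy N ys → proj₁ (decomposition (val ys)) ≡ ys
greedy≡decomposition ys g =
  greedy-unique _ ys (proj₁ (proj₂ (decomposition (val ys)))) g (proj₂ (proj₂ (decomposition (val ys))))

hasDecomp⇒summands : ∀ {k m} → HasDecomp k m → summands m ≡ k
hasDecomp⇒summands {k} {m} h with find h
... | xs , mem , length≡k , value≡m = begin
  summands m                                  ≡⟨ cong summands (sym val≡m) ⟩
  length (proj₁ (decomposition (val ys)))     ≡⟨ cong length (greedy≡decomposition ys g) ⟩
  length (reverse xs)                         ≡⟨ length-reverse xs ⟩
  length xs                                   ≡⟨ length≡k ⟩
  k                                           ∎
  where
  open ≡-Reasoning
  ys : List ℕ
  ys = reverse xs
  g : Greedy m ys
  g = legal⇒greedy m xs (∈legalIndexLists⇒legal m xs mem)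
  val≡m : val ys ≡ m
  val≡m = trans (val-reverse xs) (trans (sym (value≡val xs)) value≡m)

summands⇒hasDecomp : ∀ {k m} → summands m ≡ k → HasDecomp k m
summands⇒hasDecomp {m = m} refl with decomposition m
... | ys , g , v =
  lose (legal⇒∈legalIndexLists m (reverse ys) (greedy⇒legal m ys g))
       (length-reverse ys , trans (value≡val (reverse ys)) (trans (val-reverse ys) v))

summands-shift : ∀ ℓ m → 1 ≤ ℓ → m < A (suc (lim ℓ)) → summands (A ℓ + m) ≡ suc (summands m)
summands-shift ℓ m 1≤ℓ m<A with decomposition m
... | ys , g , v =
  trans (cong (λ n → summands (A ℓ + n)) (sym v))
        (cong length (greedy≡decomposition (ℓ ∷ ys) (1≤ℓ , ≤-refl , greedy-tighten (lim ℓ) ys g ys<A)))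
  where
  ys<A : val ys < A (suc (lim ℓ))
  ys<A = subst (_< A (suc (lim ℓ))) (sym v) m<A

module _ {X : Set} {P Q : X → Set} (P? : ∀ x → Dec (P x)) (Q? : ∀ x → Dec (Q x)) where

  count-cong : ∀ xs → All (λ x → (P x → Q x) × (Q x → P x)) xs →
               length (filter P? xs) ≡ length (filter Q? xs)
  count-cong []       []               = refl
  count-cong (x ∷ xs) ((P⇒Q , Q⇒P) ∷ agree) with P? x | Q? x
  ... | yes _  | yes _  = cong suc (count-cong xs agree)
  ... | yes px | no ¬qx = ⊥-elim (¬qx (P⇒Q px))
  ... | no ¬px | yes qx = ⊥-elim (¬px (Q⇒P qx))
  ... | no _   | no _   = count-cong xs agree

module _ {X : Set} {P : X → Set} (P? : ∀ x → Dec (P x)) where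

  count-++ : ∀ xs ys → length (filter P? (xs ++ ys)) ≡ length (filter P? xs) + length (filter P? ys)
  count-++ xs ys = trans (cong length (filter-++ P? xs ys)) (length-++ (filter P? xs))

  count-map : ∀ {Y : Set} (f : Y → X) xs → length (filter P? (map f xs)) ≡ length (filter (λ x → P? (f x)) xs)
  count-map f []       = refl
  count-map f (x ∷ xs) with P? (f x)
  ... | yes _ = cong suc (count-map f xs)
  ... | no  _ = count-map f xs

upTo-+ : ∀ m k → upTo (m + k) ≡ upTo k ++ applyUpTo (_+ k) m
upTo-+ zero    k = sym (++-identityʳ (upTo k))
upTo-+ (suc m) k = begin
  upTo (suc (m + k))                              ≡⟨ sym (upTo-∷ʳ (m + k)) ⟩
  upTo (m + k) ++ [ m + k ]                       ≡⟨ cong (_++ [ m + k ]) (upTo-+ m k) ⟩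
  (upTo k ++ applyUpTo (_+ k) m) ++ [ m + k ]     ≡⟨ ++-assoc (upTo k) _ _ ⟩
  upTo k ++ (applyUpTo (_+ k) m ++ [ m + k ])     ≡⟨ cong (upTo k ++_) (applyUpTo-∷ʳ (_+ k) m) ⟩
  upTo k ++ applyUpTo (_+ k) (suc m)              ∎
  where open ≡-Reasoning

count : ℕ → ℕ → ℕ
count k t = length (filter (λ m → summands m ≟ k) (upTo t))

count⁻ : ℕ → ℕ → ℕ
count⁻ k t = length (filter (λ m → suc (summands m) ≟ k) (upTo t))

count⁻-zero : ∀ t → count⁻ 0 t ≡ 0
count⁻-zero t = cong length (filter-none (λ m → suc (summands m) ≟ 0) (All.universal (λ _ → 1+n≢0) (upTo t)))

count⁻-suc : ∀ k t → count⁻ (suc k) t ≡ count k t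
count⁻-suc k t = cong length (filter-≐ (λ m → suc (summands m) ≟ suc k) (λ m → summands m ≟ k)
                                       (suc-injective , cong suc) (upTo t))

-- The numbers below A (ℓ + 1) are those below A ℓ together with A ℓ + m
-- for m < A (1 + lim ℓ), and the latter have one summand more than m.
count-step : ∀ ℓ j k → 1 ≤ ℓ → lim ℓ ≡ j → count k (A (suc ℓ)) ≡ count k (A ℓ) + count⁻ k (A (suc j))
count-step ℓ _ k 1≤ℓ refl = begin
  count k (A (suc ℓ))                                               ≡⟨ cong (count k) (trans (sym (A-step ℓ)) (+-comm (A ℓ) t)) ⟩
  length (filter P? (upTo (t + A ℓ)))                               ≡⟨ cong (λ ms → length (filter P? ms)) (upTo-+ t (A ℓ)) ⟩
  length (filter P? (upTo (A ℓ) ++ applyUpTo (_+ A ℓ) t))           ≡⟨ count-++ P? (upTo (A ℓ)) _ ⟩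
  count k (A ℓ) + length (filter P? (applyUpTo (_+ A ℓ) t))         ≡⟨ cong (λ ms → count k (A ℓ) + length (filter P? ms)) (sym (map-upTo (_+ A ℓ) t)) ⟩
  count k (A ℓ) + length (filter P? (map (_+ A ℓ) (upTo t)))        ≡⟨ cong (_+_ (count k (A ℓ))) (count-map P? (_+ A ℓ) (upTo t)) ⟩
  count k (A ℓ) + length (filter (λ m → P? (m + A ℓ)) (upTo t))     ≡⟨ cong (_+_ (count k (A ℓ))) (count-cong _ _ (upTo t) (All.tabulate shifted)) ⟩
  count k (A ℓ) + count⁻ k t                                        ∎
  where
  open ≡-Reasoning
  t : ℕ
  t = A (suc (lim ℓ))
  P? : ∀ m → Dec (summands m ≡ k)
  P? m = summands m ≟ k
  shifted : ∀ {m} → m ∈ upTo t → (summands (m + A ℓ) ≡ k → suc (summands m) ≡ k) × (suc (summands m) ≡ k → summands (m + A ℓ) ≡ k)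
  shifted {m} m∈ = trans (sym e) , trans e
    where
    e : summands (m + A ℓ) ≡ suc (summands m)
    e = trans (cong summands (+-comm m (A ℓ))) (summands-shift ℓ m 1≤ℓ (∈-upTo⁻ m∈))

p≡count : ∀ n k → p n k ≡ count k (A (1 + 2 * n))
p≡count n k =
  trans (cong (λ t → length (filter (hasDecomp? k) (upTo t))) (a≡A (1 + 2 * n)))
        (cong length (filter-≐ (hasDecomp? k) (λ m → summands m ≟ k)
                               (hasDecomp⇒summands , summands⇒hasDecomp) (upTo (A (1 + 2 * n)))))

-- p⁻ n k = p n (k − 1), and 0 for k = 0: the coefficients of y·F(x, y).
p⁻ : ℕ → ℕ → ℕ
p⁻ n zero    = 0
p⁻ n (suc k) = p n k

p⁻≡count⁻ : ∀ n k → p⁻ n k ≡ count⁻ k (A (1 + 2 * n))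
p⁻≡count⁻ n zero    = sym (count⁻-zero (A (1 + 2 * n)))
p⁻≡count⁻ n (suc k) = trans (p≡count n k) (sym (count⁻-suc k (A (1 + 2 * n))))

lim-odd : ∀ n → lim (suc (suc (suc (2 * n)))) ≡ 2 * n
lim-odd zero    = refl
lim-odd (suc n) rewrite *-suc 2 n = cong (λ i → suc (suc i)) (lim-odd n)

lim-even : ∀ n → lim (suc (suc (suc (suc (2 * n))))) ≡ 2 * n
lim-even zero    = refl
lim-even (suc n) rewrite *-suc 2 n = cong (λ i → suc (suc i)) (lim-even n)

p-at-odd : ∀ n k → p (suc n) k ≡ count k (A (suc (suc (suc (2 * n)))))
p-at-odd n k = trans (p≡count (suc n) k) (cong (λ i → count k (A (suc i))) (*-suc 2 n))

p-recurrence : ∀ n k → p (suc (suc n)) k ≡ p (suc n) k + 2 * p⁻ n k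
p-recurrence n k = begin
  p (suc (suc n)) k                                        ≡⟨ p-at-odd (suc n) k ⟩
  count k (A (3 + 2 * suc n))                              ≡⟨ cong (λ i → count k (A (3 + i))) (*-suc 2 n) ⟩
  count k (A (4 + o))                                      ≡⟨ count-step (3 + o) (2 * n) k (s≤s z≤n) (lim-even n) ⟩
  count k (A (3 + o)) + count⁻ k (A o)                     ≡⟨ cong (_+ count⁻ k (A o)) (count-step (2 + o) (2 * n) k (s≤s z≤n) (lim-odd n)) ⟩
  (count k (A (2 + o)) + count⁻ k (A o)) + count⁻ k (A o)  ≡⟨ cong₂ (λ c d → (c + d) + d) (sym (p-at-odd n k)) (sym (p⁻≡count⁻ n k)) ⟩
  (p (suc n) k + p⁻ n k) + p⁻ n k                          ≡⟨ regroup (p (suc n) k) (p⁻ n k) ⟩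
  p (suc n) k + 2 * p⁻ n k                                 ∎
  where
  open ≡-Reasoning
  o : ℕ
  o = 1 + 2 * n
  regroup : ∀ x y → (x + y) + y ≡ x + 2 * y
  regroup = solve-∀

sumℤ-++ : ∀ xs ys → sumℤ (xs ++ ys) ≡ sumℤ xs ℤ.+ sumℤ ys
sumℤ-++ []       ys = sym (ℤ.+-identityˡ (sumℤ ys))
sumℤ-++ (x ∷ xs) ys = trans (cong (ℤ._+_ x) (sumℤ-++ xs ys)) (sym (ℤ.+-assoc x (sumℤ xs) (sumℤ ys)))

sumℤ-concatMap : ∀ (f : ℕ → List ℤ) xs → sumℤ (concatMap f xs) ≡ sumℤ (map (λ x → sumℤ (f x)) xs)
sumℤ-concatMap f []       = refl
sumℤ-concatMap f (x ∷ xs) = trans (sumℤ-++ (f x) (concat (map f xs))) (cong (ℤ._+_ (sumℤ (f x))) (sumℤ-concatMap f xs))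

sumℤ-zero-prefix : ∀ (h : ℕ → ℤ) m ys → (∀ {j} → j < m → h j ≡ + 0) →
                   sumℤ (map h (upTo m ++ ys)) ≡ sumℤ (map h ys)
sumℤ-zero-prefix h m ys vanish = go (upTo m) (All.tabulate (λ j∈ → vanish (∈-upTo⁻ j∈)))
  where
  go : ∀ xs → All (λ x → h x ≡ + 0) xs → sumℤ (map h (xs ++ ys)) ≡ sumℤ (map h ys)
  go []       []         = refl
  go (x ∷ xs) (hx≡0 ∷ z) =
    trans (cong (ℤ._+ sumℤ (map h (xs ++ ys))) hx≡0) (trans (ℤ.+-identityˡ _) (go xs z))

∸-gap : ∀ c {m j} → j < m → (c + m) ∸ j ≡ c + suc (m ∸ suc j)
∸-gap c {suc m} {zero}  _         = refl
∸-gap c {suc m} {suc j} (s≤s j<m) = trans (cong (_∸ suc j) (+-suc c m)) (∸-gap c j<m)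

yshift : (ℕ → ℤ) → ℕ → ℤ
yshift g zero    = + 0
yshift g (suc k) = g k

-- column g d k is the coefficient of yᵏ in g(y)·D_d(y), where D_d(y) is
-- the coefficient of xᵈ in the denominator 1 − x − 2x²y.
column : (ℕ → ℤ) → ℕ → ℕ → ℤ
column g d k = sumℤ (map (λ j → g j ℤ.* denom d (k ∸ j)) (upTo (suc k)))

⋆denom-columns : ∀ f n k → (f ⋆ denom) n k ≡ sumℤ (map (λ i → column (f i) (n ∸ i) k) (upTo (suc n)))
⋆denom-columns f n k = sumℤ-concatMap (λ i → map (λ j → f i j ℤ.* denom (n ∸ i) (k ∸ j)) (upTo (suc k))) (upTo (suc n))

vanishing-term : ∀ (g : ℕ → ℤ) d k j → denom d (k ∸ j) ≡ + 0 → g j ℤ.* denom d (k ∸ j) ≡ + 0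
vanishing-term g d k j zero-coeff = trans (cong (g j ℤ.*_) zero-coeff) (ℤ.*-zeroʳ (g j))

column-constant : ∀ g d k → (∀ e → denom d (suc e) ≡ + 0) → column g d k ≡ g k ℤ.* denom d 0
column-constant g d k positive-vanish = begin
  column g d k                                ≡⟨ cong (λ js → sumℤ (map h js)) (upTo-+ 1 k) ⟩
  sumℤ (map h (upTo k ++ [ k ]))              ≡⟨ sumℤ-zero-prefix h k [ k ] (λ j<k → vanishing-term g d k _
                                                    (subst (λ e → denom d e ≡ + 0) (sym (∸-gap 0 j<k)) (positive-vanish _))) ⟩
  g k ℤ.* denom d (k ∸ k) ℤ.+ + 0             ≡⟨ cong (λ e → g k ℤ.* denom d e ℤ.+ + 0) (n∸n≡0 k) ⟩
  g k ℤ.* denom d 0 ℤ.+ + 0                   ≡⟨ ℤ.+-identityʳ _ ⟩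
  g k ℤ.* denom d 0                           ∎
  where
  open ≡-Reasoning
  h : ℕ → ℤ
  h j = g j ℤ.* denom d (k ∸ j)

column-0 : ∀ g k → column g 0 k ≡ g k
column-0 g k = trans (column-constant g 0 k (λ _ → refl)) (ℤ.*-identityʳ (g k))

column-1 : ∀ g k → column g 1 k ≡ - g k
column-1 g k = trans (column-constant g 1 k (λ _ → refl)) (trans (ℤ.*-comm (g k) (- + 1)) (ℤ.-1*i≡-i (g k)))

column-2 : ∀ g k → column g 2 k ≡ - (+ 2 ℤ.* yshift g k)
column-2 g zero    = trans (ℤ.+-identityʳ _) (ℤ.*-zeroʳ (g 0))
column-2 g (suc k) = begin
  column g 2 (suc k)                                              ≡⟨ cong (λ js → sumℤ (map h js)) (upTo-+ 2 k) ⟩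
  sumℤ (map h (upTo k ++ k ∷ suc k ∷ []))                         ≡⟨ sumℤ-zero-prefix h k _ (λ j<k → vanishing-term g 2 (suc k) _ (cong (denom 2) (∸-gap 1 j<k))) ⟩
  h k ℤ.+ (h (suc k) ℤ.+ + 0)                                     ≡⟨ cong₂ (λ d e → g k ℤ.* denom 2 d ℤ.+ (g (suc k) ℤ.* denom 2 e ℤ.+ + 0)) (m+n∸n≡m 1 k) (n∸n≡0 k) ⟩
  g k ℤ.* - (+ 2) ℤ.+ (g (suc k) ℤ.* + 0 ℤ.+ + 0)                 ≡⟨ collect (g k) (g (suc k)) ⟩
  - (+ 2 ℤ.* g k)                                                 ∎
  where
  open ≡-Reasoning
  h : ℕ → ℤ
  h j = g j ℤ.* denom 2 (suc k ∸ j)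
  collect : ∀ a b → a ℤ.* - (+ 2) ℤ.+ (b ℤ.* + 0 ℤ.+ + 0) ≡ - (+ 2 ℤ.* a)
  collect = ℤ-Solver.solve-∀

column-high : ∀ g d k → column g (suc (suc (suc d))) k ≡ + 0
column-high g d k =
  trans (cong (λ js → sumℤ (map h js)) (sym (++-identityʳ (upTo (suc k)))))
        (sumℤ-zero-prefix h (suc k) [] (λ {j} _ → ℤ.*-zeroʳ (g j)))
  where
  h : ℕ → ℤ
  h j = g j ℤ.* denom (suc (suc (suc d))) (k ∸ j)

⋆denom-0 : ∀ f k → (f ⋆ denom) 0 k ≡ f 0 k
⋆denom-0 f k = trans (⋆denom-columns f 0 k) (trans (ℤ.+-identityʳ _) (column-0 (f 0) k))

⋆denom-1 : ∀ f k → (f ⋆ denom) 1 k ≡ f 1 k ℤ.- f 0 k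
⋆denom-1 f k = begin
  (f ⋆ denom) 1 k                                   ≡⟨ ⋆denom-columns f 1 k ⟩
  column (f 0) 1 k ℤ.+ (column (f 1) 0 k ℤ.+ + 0)    ≡⟨ cong₂ (λ a b → a ℤ.+ (b ℤ.+ + 0)) (column-1 (f 0) k) (column-0 (f 1) k) ⟩
  - f 0 k ℤ.+ (f 1 k ℤ.+ + 0)                        ≡⟨ rearrange (f 0 k) (f 1 k) ⟩
  f 1 k ℤ.- f 0 k                                   ∎
  where
  open ≡-Reasoning
  rearrange : ∀ a b → - a ℤ.+ (b ℤ.+ + 0) ≡ b ℤ.- a
  rearrange = ℤ-Solver.solve-∀

⋆denom-high : ∀ f n k → (f ⋆ denom) (suc (suc n)) k ≡ f (suc (suc n)) k ℤ.- f (suc n) k ℤ.- + 2 ℤ.* yshift (f n) k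
⋆denom-high f n k = begin
  (f ⋆ denom) (suc (suc n)) k
    ≡⟨ ⋆denom-columns f (suc (suc n)) k ⟩
  sumℤ (map c (upTo (3 + n)))
    ≡⟨ cong (λ is → sumℤ (map c is)) (upTo-+ 3 n) ⟩
  sumℤ (map c (upTo n ++ n ∷ suc n ∷ suc (suc n) ∷ []))
    ≡⟨ sumℤ-zero-prefix c n _ (λ {i} i<n → trans (cong (λ d → column (f i) d k) (∸-gap 2 i<n)) (column-high (f i) (n ∸ suc i) k)) ⟩
  c n ℤ.+ (c (suc n) ℤ.+ (c (suc (suc n)) ℤ.+ + 0))
    ≡⟨ cong₃ (λ d₂ d₁ d₀ → column (f n) d₂ k ℤ.+ (column (f (suc n)) d₁ k ℤ.+ (column (f (suc (suc n))) d₀ k ℤ.+ + 0)))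
             (m+n∸n≡m 2 n) (m+n∸n≡m 1 n) (n∸n≡0 n) ⟩
  column (f n) 2 k ℤ.+ (column (f (suc n)) 1 k ℤ.+ (column (f (suc (suc n))) 0 k ℤ.+ + 0))
    ≡⟨ cong₃ (λ a b e → a ℤ.+ (b ℤ.+ (e ℤ.+ + 0))) (column-2 (f n) k) (column-1 (f (suc n)) k) (column-0 (f (suc (suc n))) k) ⟩
  - (+ 2 ℤ.* yshift (f n) k) ℤ.+ (- f (suc n) k ℤ.+ (f (suc (suc n)) k ℤ.+ + 0))
    ≡⟨ rearrange (yshift (f n) k) (f (suc n) k) (f (suc (suc n)) k) ⟩
  f (suc (suc n)) k ℤ.- f (suc n) k ℤ.- + 2 ℤ.* yshift (f n) k
    ∎
  where
  open ≡-Reasoning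
  c : ℕ → ℤ
  c i = column (f i) (suc (suc n) ∸ i) k
  cong₃ : ∀ {X Y Z W : Set} (h : X → Y → Z → W) {x x′ y y′ z z′} → x ≡ x′ → y ≡ y′ → z ≡ z′ → h x y z ≡ h x′ y′ z′
  cong₃ h refl refl refl = refl
  rearrange : ∀ s a b → - (+ 2 ℤ.* s) ℤ.+ (- a ℤ.+ (b ℤ.+ + 0)) ≡ b ℤ.- a ℤ.- + 2 ℤ.* s
  rearrange = ℤ-Solver.solve-∀

yshift-F : ∀ n k → yshift (F n) k ≡ + p⁻ n k
yshift-F n zero    = refl
yshift-F n (suc k) = refl

recurrence-cancels : ∀ a b → + (a + 2 * b) ℤ.- + a ℤ.- + 2 ℤ.* + b ≡ + 0
recurrence-cancels a b =
  trans (cong (λ z → z ℤ.- + a ℤ.- + 2 ℤ.* + b) (trans (ℤ.pos-+ a (2 * b)) (cong (ℤ._+_ (+ a)) (ℤ.pos-* 2 b))))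
        (cancel (+ a) (+ b))
  where
  cancel : ∀ x y → x ℤ.+ + 2 ℤ.* y ℤ.- x ℤ.- + 2 ℤ.* y ≡ + 0
  cancel = ℤ-Solver.solve-∀

-- The coefficients of x⁰
-- and x¹ only involve p 0 k and p 1 k, which count the numbers below
-- a₁ = 1 and a₃ = 3 and are evaluated directly from the definitions; the
-- coefficients of xⁿ⁺² vanish by the recurrence for p.
proposition2p3 : ∀ (n k : ℕ) → (F ⋆ denom) n k ≡ numer n k
proposition2p3 zero          k = trans (⋆denom-0 F k) (row-0 k)
  where
  row-0 : ∀ k → F 0 k ≡ numer 0 k
  row-0 zero    = refl
  row-0 (suc k) = refl
proposition2p3 (suc zero)    k = trans (⋆denom-1 F k) (row-1 k)
  where
  row-1 : ∀ k → F 1 k ℤ.- F 0 k ≡ numer 1 k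
  row-1 zero          = refl
  row-1 (suc zero)    = refl
  row-1 (suc (suc k)) = refl
proposition2p3 (suc (suc n)) k = begin
  (F ⋆ denom) (suc (suc n)) k                                         ≡⟨ ⋆denom-high F n k ⟩
  F (suc (suc n)) k ℤ.- F (suc n) k ℤ.- + 2 ℤ.* yshift (F n) k         ≡⟨ cong₂ (λ a s → + a ℤ.- F (suc n) k ℤ.- + 2 ℤ.* s) (p-recurrence n k) (yshift-F n k) ⟩
  + (p (suc n) k + 2 * p⁻ n k) ℤ.- F (suc n) k ℤ.- + 2 ℤ.* + p⁻ n k    ≡⟨ recurrence-cancels (p (suc n) k) (p⁻ n k) ⟩
  + 0                                                                 ∎
  where open ≡-Reasoning
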